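{- For every finite graph $G$ with at least one vertex there exists a Eulerian subgraph $G'$ of $G$ such that $$\frac{|E(G')|}{|V(G')|}\ge\frac{|E(G)|+1}{|V(G)|}-1.$$
   Context: A graph is Eulerian if it is connected and every vertex has even degree (a single vertex with no edges counts as Eulerian). -}

module Defs where

open import Data.Nat using (ℕ; zero; suc; _+_; _*_; _≤_; _<ᵇ_)
open import Data.Nat.Divisibility using (_∣_)
open import Data.Bool using (Bool; true; false; _∧_; if_then_else_)
open import Data.Fin using (Fin; toℕ)
open import Data.List using (List; map)
open import Data.Nat.ListAction using (sum)
open import Data.List using (allFin)
open import Data.Product using (_×_)
open import Relation.Binary.PropositionalEquality using (_≡_)

count : ∀ {n} → (Fin n → Bool) → ℕ
count {n} p = sum (map (λ i → if p i then 1 else 0) (allFin n))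

record Graph : Set where
  field
    n     : ℕ
    adj   : Fin n → Fin n → Bool
    sym   : ∀ i j → adj i j ≡ adj j i
    irref : ∀ i → adj i i ≡ false

open Graph public

edgeCount : ∀ {n} → (Fin n → Fin n → Bool) → ℕ
edgeCount {n} A = sum (map (λ i → count (λ j → (toℕ i <ᵇ toℕ j) ∧ A i j)) (allFin n))

record Subgraph (G : Graph) : Set where
  field
    V'     : Fin (n G) → Bool
    E'     : Fin (n G) → Fin (n G) → Bool
    E'-sym : ∀ i j → E' i j ≡ E' j i
    E'⊆E   : ∀ i j → E' i j ≡ true → adj G i j ≡ true
    E'-endpoints : ∀ i j → E' i j ≡ true → V' i ≡ true × V' j ≡ true

open Subgraph public

module _ {G : Graph} (H : Subgraph G) where

  vCount : ℕ
  vCount = count (V' H)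

  eCount : ℕ
  eCount = edgeCount (E' H)

  degree : Fin (n G) → ℕ
  degree v = count (E' H v)

  data Reach : Fin (n G) → Fin (n G) → Set where
    here : ∀ {u} → Reach u u
    step : ∀ {u v w} → E' H u v ≡ true → Reach v w → Reach u w

  Connected : Set
  Connected = (1 ≤ vCount) × (∀ u v → V' H u ≡ true → V' H v ≡ true → Reach u v)

  Eulerian : Set
  Eulerian = Connected × (∀ v → V' H v ≡ true → 2 ∣ degree v)

module Submission where

-- Graphs are symmetric irreflexive boolean relations on Fin N; edges are counted through
-- degree sums (Σ deg = 2·#edges, the handshake lemma).
--
-- 1. Cycle lemma: a graph with an edge and at least as many edges as non-isolated
--    vertices has a nonempty even subgraph. Induction on the number of edges: delete
--    the edge at a leaf, or suppress a vertex v with neighbours u, w (replace vu, vw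
--    by uw; if uw is already an edge, the triangle vuw is even).
-- 2. Large even subgraph: starting from ∅, keep adding to E a nonempty even subgraph
--    of G ∖ E while G ∖ E has at least |V(G)| edges. The final E is even with
--    |E(G)| + 1 ≤ |E(E)| + |V(G)|.
-- 3. Averaging: some connected component H of E, an Eulerian subgraph (computed as a
--    ball of radius |V(G)|), has |E(E)|·|V(H)| ≤ |E(H)|·|V(G)|.
--
-- Multiplying the inequality of 2 by |V(H)| and applying 3 gives the theorem.

open import Defs hiding (sym)
open import Data.Nat using (ℕ; zero; suc; _+_; _*_; _≤_; _<_; z≤n; s≤s; s≤s⁻¹; _≤?_; _<ᵇ_)
open import Data.Nat.Properties
  using ( +-assoc; +-comm; +-identityʳ; +-cancelʳ-≡; +-cancelʳ-≤; +-cancelˡ-<; +-mono-≤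
        ; +-monoʳ-<; +-monoʳ-≤; +-monoˡ-<; +-monoˡ-≤; *-assoc; *-suc; *-distribʳ-+; *-distribˡ-+
        ; *-cancelˡ-<; *-cancelˡ-≡; *-cancelˡ-≤; *-monoʳ-≤; *-monoˡ-≤; +-*-semiring
        ; ≤-refl; ≤-reflexive; ≤-trans; <⇒≤; ≰⇒>; 1+n≰n; m<m+n; m≤m+n; m≤n+m; module ≤-Reasoning )
open import Data.Nat.Divisibility using (_∣_; divides)
open import Data.Nat.Induction using (<-wellFounded)
import Data.Nat.ListAction as List
open import Data.Bool using (Bool; true; false; _∧_; _∨_; not; _xor_; if_then_else_)
open import Data.Bool.Properties
  using ( ∧-comm; ∧-identityʳ; ∧-zeroʳ; ∨-comm; ∨-identityʳ; xor-assoc; xor-identityʳ; xor-same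
        ; not-distribˡ-xor; not-involutive ) renaming (_≟_ to _≟ᵇ_)
open import Data.Fin using (Fin; zero; suc; toℕ; fromℕ<)
open import Data.Fin.Properties using (_≟_; toℕ-injective; any?)
open import Data.List using (map; tabulate; allFin)
open import Data.Product using (Σ; _×_; _,_; proj₂)
open import Data.Sum using (_⊎_; inj₁; inj₂)
open import Data.Empty using (⊥-elim)
open import Function using (_∘_; case_of_)
open import Induction.WellFounded using (Acc; acc)
open import Relation.Binary.PropositionalEquality
open import Relation.Nullary using (¬_; does; yes; no)
open import Relation.Nullary.Decidable using (dec-true; dec-false)
open import Algebra.Properties.Semiring.Sum +-*-semiring
  using (sum; sum-cong-≗; ∑-distrib-+; ∑-comm; *-distribˡ-sum; sum-replicate-zero)

χ : Bool → ℕ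
χ b = if b then 1 else 0

card : ∀ {n} → (Fin n → Bool) → ℕ
card p = sum (λ i → χ (p i))

list-sum≡sum : ∀ {n} (f : Fin n → ℕ) → List.sum (map f (allFin n)) ≡ sum f
list-sum≡sum f = over-tabulate f (λ i → i)
  where
  over-tabulate : ∀ {A : Set} {n} (f : A → ℕ) (g : Fin n → A) →
                  List.sum (map f (tabulate g)) ≡ sum (f ∘ g)
  over-tabulate {n = zero}  f g = refl
  over-tabulate {n = suc n} f g = cong (f (g zero) +_) (over-tabulate f (g ∘ suc))

count≡card : ∀ {n} (p : Fin n → Bool) → count p ≡ card p
count≡card p = list-sum≡sum (λ i → χ (p i))

sum-mono : ∀ {n} {f g : Fin n → ℕ} → (∀ i → f i ≤ g i) → sum f ≤ sum g
sum-mono {zero}  f≤g = z≤n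
sum-mono {suc n} f≤g = +-mono-≤ (f≤g zero) (sum-mono (f≤g ∘ suc))

term≤sum : ∀ {n} (f : Fin n → ℕ) (i : Fin n) → f i ≤ sum f
term≤sum f zero    = m≤m+n _ _
term≤sum f (suc i) = ≤-trans (term≤sum (f ∘ suc) i) (m≤n+m _ _)

positive-term : ∀ {n} (f : Fin n → ℕ) → 1 ≤ sum f → Σ (Fin n) λ i → 1 ≤ f i
positive-term {suc n} f pos with f zero in eq
... | suc _ = zero , subst (1 ≤_) (sym eq) (s≤s z≤n)
... | zero with positive-term (f ∘ suc) pos
...   | i , fi = suc i , fi

χ≤1 : ∀ b → χ b ≤ 1
χ≤1 true  = ≤-refl
χ≤1 false = z≤n

card-cong : ∀ {n} {p q : Fin n → Bool} → (∀ i → p i ≡ q i) → card p ≡ card q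
card-cong p≗q = sum-cong-≗ (cong χ ∘ p≗q)

card-mono : ∀ {n} {p q : Fin n → Bool} → (∀ i → p i ≡ true → q i ≡ true) → card p ≤ card q
card-mono {p = p} {q} p⊆q = sum-mono (λ i → χ-mono (p i) (q i) (p⊆q i))
  where
  χ-mono : ∀ a b → (a ≡ true → b ≡ true) → χ a ≤ χ b
  χ-mono false b   _   = z≤n
  χ-mono true  b a⇒b rewrite a⇒b refl = ≤-refl

card-all : ∀ n → card {n} (λ _ → true) ≡ n
card-all zero    = refl
card-all (suc n) = cong suc (card-all n)

card≤n : ∀ {n} (p : Fin n → Bool) → card p ≤ n
card≤n {n} p = ≤-trans (sum-mono (λ i → χ≤1 (p i))) (≤-reflexive (card-all n))

member⇒card-pos : ∀ {n} (p : Fin n → Bool) (i : Fin n) → p i ≡ true → 1 ≤ card p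
member⇒card-pos p i pi = subst (λ b → χ b ≤ card p) pi (term≤sum (λ j → χ (p j)) i)

card-witness : ∀ {n} (p : Fin n → Bool) → 1 ≤ card p → Σ (Fin n) λ i → p i ≡ true
card-witness p pos with positive-term (λ i → χ (p i)) pos
... | i , χpi with p i in pi
...   | true = i , pi

card-empty : ∀ {n} → card {n} (λ _ → false) ≡ 0
card-empty {n} = sum-replicate-zero n

card-split : ∀ {n} (k p : Fin n → Bool) →
             card p ≡ card (λ i → k i ∧ p i) + card (λ i → not (k i) ∧ p i)
card-split k p = trans (sum-cong-≗ (λ i → χ-split (k i) (p i)))
                       (∑-distrib-+ (λ i → χ (k i ∧ p i)) (λ i → χ (not (k i) ∧ p i)))
  where
  χ-split : ∀ c b → χ b ≡ χ (c ∧ b) + χ (not c ∧ b)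
  χ-split true  b = sym (+-identityʳ _)
  χ-split false b = refl

card-xor : ∀ {n} (p q : Fin n → Bool) →
           card (λ j → p j xor q j) + 2 * card (λ j → p j ∧ q j) ≡ card p + card q
card-xor p q = begin
    card (λ j → p j xor q j) + 2 * card (λ j → p j ∧ q j)
  ≡⟨ cong (card (λ j → p j xor q j) +_) (*-distribˡ-sum 2 (λ j → χ (p j ∧ q j))) ⟩
    card (λ j → p j xor q j) + sum (λ j → 2 * χ (p j ∧ q j))
  ≡⟨ ∑-distrib-+ (λ j → χ (p j xor q j)) (λ j → 2 * χ (p j ∧ q j)) ⟨
    sum (λ j → χ (p j xor q j) + 2 * χ (p j ∧ q j))
  ≡⟨ sum-cong-≗ (λ j → χ-xor (p j) (q j)) ⟩
    sum (λ j → χ (p j) + χ (q j))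
  ≡⟨ ∑-distrib-+ (λ j → χ (p j)) (λ j → χ (q j)) ⟩
    card p + card q
  ∎
  where
  open ≡-Reasoning
  χ-xor : ∀ a b → χ (a xor b) + 2 * χ (a ∧ b) ≡ χ a + χ b
  χ-xor true  true  = refl
  χ-xor true  false = refl
  χ-xor false true  = refl
  χ-xor false false = refl

_==_ : ∀ {n} → Fin n → Fin n → Bool
i == j = does (i ≟ j)

==-refl : ∀ {n} (i : Fin n) → (i == i) ≡ true
==-refl i = dec-true (i ≟ i) refl

==⇒≡ : ∀ {n} (i j : Fin n) → (i == j) ≡ true → i ≡ j
==⇒≡ i j eq with i ≟ j
... | yes i≡j = i≡j

≢⇒==false : ∀ {n} {i j : Fin n} → ¬ i ≡ j → (i == j) ≡ false
≢⇒==false {i = i} {j} i≢j = dec-false (i ≟ j) i≢j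

card-at : ∀ {n} (p : Fin n → Bool) (a : Fin n) → card (λ j → (j == a) ∧ p j) ≡ χ (p a)
card-at {suc n} p zero    = trans (cong (χ (p zero) +_) (sum-replicate-zero n)) (+-identityʳ _)
card-at {suc n} p (suc a) = card-at (p ∘ suc) a

card-remove : ∀ {n} (p : Fin n → Bool) (a : Fin n) → p a ≡ true →
              card p ≡ suc (card (λ j → not (j == a) ∧ p j))
card-remove p a pa = trans (card-split (_== a) p)
  (cong (_+ card (λ j → not (j == a) ∧ p j)) (trans (card-at p a) (cong χ pa)))

card-strict : ∀ {n} {p q : Fin n → Bool} (a : Fin n) → (∀ i → p i ≡ true → q i ≡ true) →
              p a ≡ false → q a ≡ true → suc (card p) ≤ card q
card-strict {p = p} {q} a p⊆q pa qa =
  subst (suc (card p) ≤_) (sym (card-remove q a qa)) (s≤s (card-mono p⊆q∖a))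
  where
  p⊆q∖a : ∀ i → p i ≡ true → (not (i == a) ∧ q i) ≡ true
  p⊆q∖a i pi with i == a in ia
  ... | true  with () ← trans (sym pi) (trans (cong p (==⇒≡ i a ia)) pa)
  ... | false = p⊆q i pi

odd : ℕ → Bool
odd zero    = false
odd (suc m) = not (odd m)

odd-+ : ∀ m n → odd (m + n) ≡ odd m xor odd n
odd-+ zero    n = refl
odd-+ (suc m) n = trans (cong not (odd-+ m n)) (not-distribˡ-xor (odd m) (odd n))

odd-double : ∀ m → odd (2 * m) ≡ false
odd-double m = begin
  odd (m + (m + 0))          ≡⟨ cong (λ k → odd (m + k)) (+-identityʳ m) ⟩
  odd (m + m)                ≡⟨ odd-+ m m ⟩
  odd m xor odd m            ≡⟨ xor-same (odd m) ⟩
  false                      ∎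
  where open ≡-Reasoning

odd-χ : ∀ b → odd (χ b) ≡ b
odd-χ true  = refl
odd-χ false = refl

odd-card-xor : ∀ {n} (p q : Fin n → Bool) →
               odd (card (λ j → p j xor q j)) ≡ odd (card p) xor odd (card q)
odd-card-xor p q = begin
    odd (card (λ j → p j xor q j))
  ≡⟨ xor-identityʳ _ ⟨
    odd (card (λ j → p j xor q j)) xor false
  ≡⟨ cong (odd (card (λ j → p j xor q j)) xor_) (odd-double (card (λ j → p j ∧ q j))) ⟨
    odd (card (λ j → p j xor q j)) xor odd (2 * card (λ j → p j ∧ q j))
  ≡⟨ odd-+ (card (λ j → p j xor q j)) (2 * card (λ j → p j ∧ q j)) ⟨
    odd (card (λ j → p j xor q j) + 2 * card (λ j → p j ∧ q j))
  ≡⟨ cong odd (card-xor p q) ⟩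
    odd (card p + card q)
  ≡⟨ odd-+ (card p) (card q) ⟩
    odd (card p) xor odd (card q)
  ∎
  where open ≡-Reasoning

even⇒2∣ : ∀ m → odd m ≡ false → 2 ∣ m
even⇒2∣ zero          _    = divides 0 refl
even⇒2∣ (suc zero)    ()
even⇒2∣ (suc (suc m)) even with even⇒2∣ m (trans (sym (not-involutive (odd m))) even)
... | divides q m≡q*2 = divides (suc q) (cong (λ k → suc (suc k)) m≡q*2)

Rel : ℕ → Set
Rel N = Fin N → Fin N → Bool

Symm : ∀ {N} → Rel N → Set
Symm X = ∀ i j → X i j ≡ X j i

Irrefl : ∀ {N} → Rel N → Set
Irrefl X = ∀ i → X i i ≡ false

_⊆_ : ∀ {N} → Rel N → Rel N → Set
X ⊆ Y = ∀ i j → X i j ≡ true → Y i j ≡ true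

deg : ∀ {N} → Rel N → Fin N → ℕ
deg X i = card (X i)

totalDeg : ∀ {N} → Rel N → ℕ
totalDeg X = sum (deg X)

Even : ∀ {N} → Rel N → Set
Even X = ∀ i → odd (deg X i) ≡ false

_⊕_ : ∀ {N} → Rel N → Rel N → Rel N
(X ⊕ Y) i j = X i j xor Y i j

edge : ∀ {N} → Fin N → Fin N → Rel N
edge a b i j = ((i == a) ∧ (j == b)) ∨ ((i == b) ∧ (j == a))

⊕-symm : ∀ {N} (X Y : Rel N) → Symm X → Symm Y → Symm (X ⊕ Y)
⊕-symm X Y sX sY i j = cong₂ _xor_ (sX i j) (sY i j)

⊕-irrefl : ∀ {N} (X Y : Rel N) → Irrefl X → Irrefl Y → Irrefl (X ⊕ Y)
⊕-irrefl X Y iX iY i = cong₂ _xor_ (iX i) (iY i)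

⊕-even : ∀ {N} (X Y : Rel N) → Even X → Even Y → Even (X ⊕ Y)
⊕-even X Y eX eY i = trans (odd-card-xor (X i) (Y i)) (cong₂ _xor_ (eX i) (eY i))

⊆-irrefl : ∀ {N} {X Y : Rel N} → X ⊆ Y → Irrefl Y → Irrefl X
⊆-irrefl {X = X} X⊆Y iY i with X i i in xii
... | false = refl
... | true  with () ← trans (sym (X⊆Y i i xii)) (iY i)

totalDeg-cong : ∀ {N} {X Y : Rel N} → (∀ i j → X i j ≡ Y i j) → totalDeg X ≡ totalDeg Y
totalDeg-cong X≗Y = sum-cong-≗ (λ i → card-cong (X≗Y i))

totalDeg-split : ∀ {N} (k : Rel N) (X : Rel N) →
  totalDeg X ≡ totalDeg (λ i j → k i j ∧ X i j) + totalDeg (λ i j → not (k i j) ∧ X i j)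
totalDeg-split k X = trans (sum-cong-≗ (λ i → card-split (k i) (X i)))
  (∑-distrib-+ (λ i → card (λ j → k i j ∧ X i j)) (λ i → card (λ j → not (k i j) ∧ X i j)))

totalDeg-pos : ∀ {N} (X : Rel N) i j → X i j ≡ true → 1 ≤ totalDeg X
totalDeg-pos X i j xij = ≤-trans (member⇒card-pos (X i) j xij) (term≤sum (deg X) i)

totalDeg-xor : ∀ {N} (X Y : Rel N) →
  totalDeg (X ⊕ Y) + 2 * totalDeg (λ i j → X i j ∧ Y i j) ≡ totalDeg X + totalDeg Y
totalDeg-xor X Y = begin
    totalDeg (X ⊕ Y) + 2 * totalDeg X∧Y
  ≡⟨ cong (totalDeg (X ⊕ Y) +_) (*-distribˡ-sum 2 (deg X∧Y)) ⟩
    totalDeg (X ⊕ Y) + sum (λ i → 2 * deg X∧Y i)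
  ≡⟨ ∑-distrib-+ (deg (X ⊕ Y)) (λ i → 2 * deg X∧Y i) ⟨
    sum (λ i → deg (X ⊕ Y) i + 2 * deg X∧Y i)
  ≡⟨ sum-cong-≗ (λ i → card-xor (X i) (Y i)) ⟩
    sum (λ i → deg X i + deg Y i)
  ≡⟨ ∑-distrib-+ (deg X) (deg Y) ⟩
    totalDeg X + totalDeg Y
  ∎
  where
  open ≡-Reasoning
  X∧Y : Rel _
  X∧Y i j = X i j ∧ Y i j

handshake : ∀ {N} (X : Rel N) → Symm X → Irrefl X → totalDeg X ≡ 2 * edgeCount X
handshake {N} X sX iX = begin
    totalDeg X
  ≡⟨ totalDeg-split lt X ⟩
    E + totalDeg (λ i j → not (lt i j) ∧ X i j)
  ≡⟨ cong (E +_) (totalDeg-cong below-diagonal) ⟩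
    E + sum (λ i → sum (λ j → χ (lt j i ∧ X j i)))
  ≡⟨ cong (E +_) (∑-comm (λ i j → χ (lt j i ∧ X j i))) ⟩
    E + E
  ≡⟨ cong (E +_) (+-identityʳ E) ⟨
    2 * E
  ≡⟨ cong (2 *_) (count-rows X) ⟨
    2 * edgeCount X
  ∎
  where
  open ≡-Reasoning
  lt : Rel N
  lt i j = toℕ i <ᵇ toℕ j
  E : ℕ
  E = totalDeg (λ i j → lt i j ∧ X i j)

  <ᵇ-trichotomy : ∀ m n → (m <ᵇ n) ≡ false → (n <ᵇ m) ≡ false → m ≡ n
  <ᵇ-trichotomy zero    zero    _ _ = refl
  <ᵇ-trichotomy (suc m) (suc n) p q = cong suc (<ᵇ-trichotomy m n p q)

  <ᵇ-asym : ∀ m n → (m <ᵇ n) ≡ true → (n <ᵇ m) ≡ false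
  <ᵇ-asym zero    (suc n) _ = refl
  <ᵇ-asym (suc m) (suc n) p = <ᵇ-asym m n p

  below-diagonal : ∀ i j → (not (lt i j) ∧ X i j) ≡ (lt j i ∧ X j i)
  below-diagonal i j with lt i j in ij | lt j i in ji
  ... | true  | true  with () ← trans (sym ji) (<ᵇ-asym (toℕ i) (toℕ j) ij)
  ... | true  | false = refl
  ... | false | true  = sX i j
  ... | false | false rewrite toℕ-injective (<ᵇ-trichotomy (toℕ i) (toℕ j) ij ji) = iX j

  count-rows : ∀ (Y : Rel N) → edgeCount Y ≡ totalDeg (λ i j → lt i j ∧ Y i j)
  count-rows Y = trans (list-sum≡sum (λ i → count (λ j → lt i j ∧ Y i j)))
                       (sum-cong-≗ (λ i → count≡card (λ j → lt i j ∧ Y i j)))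

edge-symm : ∀ {N} (a b : Fin N) → Symm (edge a b)
edge-symm a b i j = trans (∨-comm ((i == a) ∧ (j == b)) ((i == b) ∧ (j == a)))
  (cong₂ _∨_ (∧-comm (i == b) (j == a)) (∧-comm (i == a) (j == b)))

edge-ends : ∀ {N} (a b i j : Fin N) → edge a b i j ≡ true → (i ≡ a × j ≡ b) ⊎ (i ≡ b × j ≡ a)
edge-ends a b i j e with i == a in ia | j == b in jb | i == b in ib | j == a in ja
... | true  | true  | _    | _    = inj₁ (==⇒≡ i a ia , ==⇒≡ j b jb)
... | _     | _     | true | true = inj₂ (==⇒≡ i b ib , ==⇒≡ j a ja)
... | true  | false | true  | false with () ← e
... | true  | false | false | _     with () ← e
... | false | _     | true  | false with () ← e
... | false | _     | false | _     with () ← e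

edge-irrefl : ∀ {N} {a b : Fin N} → ¬ a ≡ b → Irrefl (edge a b)
edge-irrefl {a = a} {b} a≢b i with edge a b i i in e
... | false = refl
... | true with edge-ends a b i i e
...   | inj₁ (i≡a , i≡b) = ⊥-elim (a≢b (trans (sym i≡a) i≡b))
...   | inj₂ (i≡b , i≡a) = ⊥-elim (a≢b (trans (sym i≡a) i≡b))

edge-false : ∀ {N} (a b i j : Fin N) → ¬ (i ≡ a × j ≡ b) → ¬ (i ≡ b × j ≡ a) →
             edge a b i j ≡ false
edge-false a b i j n₁ n₂ with edge a b i j in e
... | false = refl
... | true with edge-ends a b i j e
...   | inj₁ p = ⊥-elim (n₁ p)
...   | inj₂ p = ⊥-elim (n₂ p)

edge-at : ∀ {N} (a b : Fin N) → edge a b a b ≡ true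
edge-at a b rewrite ==-refl a | ==-refl b = refl

edge⊆ : ∀ {N} {X : Rel N} → Symm X → ∀ {a b} → X a b ≡ true → edge a b ⊆ X
edge⊆ sX {a} {b} xab i j e with edge-ends a b i j e
... | inj₁ (refl , refl) = xab
... | inj₂ (refl , refl) = trans (sX b a) xab

row-∧-edge : ∀ {N} {a b : Fin N} → ¬ a ≡ b → (q : Fin N → Bool) (x : Fin N) →
  card (λ j → q j ∧ edge a b x j) ≡ χ ((x == a) ∧ q b) + χ ((x == b) ∧ q a)
row-∧-edge {N} {a} {b} a≢b q x with x == a in xa | x == b in xb
... | true  | true  = ⊥-elim (a≢b (trans (sym (==⇒≡ x a xa)) (==⇒≡ x b xb)))
... | true  | false = begin
    card (λ j → q j ∧ ((j == b) ∨ false))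
      ≡⟨ card-cong (λ j → cong (q j ∧_) (∨-identityʳ (j == b))) ⟩
    card (λ j → q j ∧ (j == b))            ≡⟨ card-cong (λ j → ∧-comm (q j) (j == b)) ⟩
    card (λ j → (j == b) ∧ q j)            ≡⟨ card-at q b ⟩
    χ (q b)                                ≡⟨ +-identityʳ _ ⟨
    χ (q b) + 0                            ∎
  where open ≡-Reasoning
... | false | true  = trans (card-cong (λ j → ∧-comm (q j) (j == a))) (card-at q a)
... | false | false = trans (card-cong (λ j → ∧-zeroʳ (q j))) (card-empty {N})

deg-edge : ∀ {N} {a b : Fin N} → ¬ a ≡ b → (x : Fin N) → deg (edge a b) x ≡ χ (x == a) + χ (x == b)
deg-edge {a = a} {b} a≢b x = trans (row-∧-edge a≢b (λ _ → true) x)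
  (cong₂ _+_ (cong χ (∧-identityʳ (x == a))) (cong χ (∧-identityʳ (x == b))))

odd-deg-edge : ∀ {N} {a b : Fin N} → ¬ a ≡ b → (x : Fin N) → odd (deg (edge a b) x) ≡ (x == a) xor (x == b)
odd-deg-edge {a = a} {b} a≢b x = trans (cong odd (deg-edge a≢b x))
  (trans (odd-+ (χ (x == a)) (χ (x == b))) (cong₂ _xor_ (odd-χ (x == a)) (odd-χ (x == b))))

totalDeg-∧-edge : ∀ {N} (X : Rel N) {a b : Fin N} → ¬ a ≡ b →
  totalDeg (λ i j → X i j ∧ edge a b i j) ≡ χ (X a b) + χ (X b a)
totalDeg-∧-edge X {a} {b} a≢b = begin
    sum (λ x → card (λ j → X x j ∧ edge a b x j))
  ≡⟨ sum-cong-≗ (λ x → row-∧-edge a≢b (X x) x) ⟩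
    sum (λ x → χ ((x == a) ∧ X x b) + χ ((x == b) ∧ X x a))
  ≡⟨ ∑-distrib-+ (λ x → χ ((x == a) ∧ X x b)) (λ x → χ ((x == b) ∧ X x a)) ⟩
    card (λ x → (x == a) ∧ X x b) + card (λ x → (x == b) ∧ X x a)
  ≡⟨ cong₂ _+_ (card-at (λ x → X x b) a) (card-at (λ x → X x a) b) ⟩
    χ (X a b) + χ (X b a)
  ∎
  where open ≡-Reasoning

totalDeg-toggle : ∀ {N} (X : Rel N) {a b : Fin N} → ¬ a ≡ b →
  totalDeg (X ⊕ edge a b) + 2 * (χ (X a b) + χ (X b a)) ≡ totalDeg X + 2
totalDeg-toggle X {a} {b} a≢b = begin
    totalDeg (X ⊕ edge a b) + 2 * (χ (X a b) + χ (X b a))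
  ≡⟨ cong (λ k → totalDeg (X ⊕ edge a b) + 2 * k) (totalDeg-∧-edge X a≢b) ⟨
    totalDeg (X ⊕ edge a b) + 2 * totalDeg (λ i j → X i j ∧ edge a b i j)
  ≡⟨ totalDeg-xor X (edge a b) ⟩
    totalDeg X + totalDeg (edge a b)
  ≡⟨ cong (totalDeg X +_) (totalDeg-∧-edge (λ _ _ → true) a≢b) ⟩
    totalDeg X + 2
  ∎
  where open ≡-Reasoning

delete-edge : ∀ {N} {X : Rel N} → Symm X → ∀ {a b} → ¬ a ≡ b → X a b ≡ true →
  totalDeg (X ⊕ edge a b) + 2 ≡ totalDeg X
delete-edge {X = X} sX {a} {b} a≢b xab = +-cancelʳ-≡ 2 _ _ (trans (+-assoc _ 2 2)
  (subst (λ c → totalDeg (X ⊕ edge a b) + 2 * c ≡ totalDeg X + 2)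
         (cong₂ (λ p q → χ p + χ q) xab (trans (sX b a) xab)) (totalDeg-toggle X a≢b)))

add-edge : ∀ {N} {X : Rel N} → Symm X → ∀ {a b} → ¬ a ≡ b → X a b ≡ false →
  totalDeg (X ⊕ edge a b) ≡ totalDeg X + 2
add-edge {X = X} sX {a} {b} a≢b xab = trans (sym (+-identityʳ _))
  (subst (λ c → totalDeg (X ⊕ edge a b) + 2 * c ≡ totalDeg X + 2)
         (cong₂ (λ p q → χ p + χ q) xab (trans (sX b a) xab)) (totalDeg-toggle X a≢b))

deg-toggle-end : ∀ {N} (X : Rel N) {a b : Fin N} → ¬ a ≡ b →
  deg (X ⊕ edge a b) a + 2 * χ (X a b) ≡ deg X a + 1
deg-toggle-end X {a} {b} a≢b = begin
    deg (X ⊕ edge a b) a + 2 * χ (X a b)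
  ≡⟨ cong (λ k → deg (X ⊕ edge a b) a + 2 * k) shared ⟨
    deg (X ⊕ edge a b) a + 2 * card (λ j → X a j ∧ edge a b a j)
  ≡⟨ card-xor (X a) (edge a b a) ⟩
    deg X a + deg (edge a b) a
  ≡⟨ cong (deg X a +_) (trans (deg-edge a≢b a)
                              (cong₂ _+_ (cong χ (==-refl a)) (cong χ (≢⇒==false a≢b)))) ⟩
    deg X a + 1
  ∎
  where
  open ≡-Reasoning
  shared : card (λ j → X a j ∧ edge a b a j) ≡ χ (X a b)
  shared = trans (row-∧-edge a≢b (X a) a)
    (trans (cong₂ (λ p q → χ (p ∧ X a b) + χ (q ∧ X a a)) (==-refl a) (≢⇒==false a≢b))
           (+-identityʳ _))

deg-toggle-away : ∀ {N} (X : Rel N) {a b x : Fin N} → ¬ x ≡ a → ¬ x ≡ b →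
  deg (X ⊕ edge a b) x ≡ deg X x
deg-toggle-away X {a} {b} {x} x≢a x≢b = card-cong λ j →
  trans (cong (X x j xor_)
              (edge-false a b x j (λ { (x≡a , _) → x≢a x≡a }) (λ { (x≡b , _) → x≢b x≡b })))
        (xor-identityʳ (X x j))

positive : ℕ → Bool
positive zero    = false
positive (suc _) = true

some : ∀ {n} → (Fin n → Bool) → Bool
some p = positive (card p)

some-intro : ∀ {n} (p : Fin n → Bool) {i} → p i ≡ true → some p ≡ true
some-intro p {i} pi with card p | member⇒card-pos p i pi
... | suc _ | _ = refl

some-elim : ∀ {n} (p : Fin n → Bool) → some p ≡ true → Σ (Fin n) λ i → p i ≡ true
some-elim p s with card p in c
... | suc _ = card-witness p (subst (1 ≤_) (sym c) (s≤s z≤n))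

some-false : ∀ {n} (p : Fin n → Bool) → some p ≡ false → ∀ i → p i ≡ false
some-false p none i with p i in pi
... | false = refl
... | true with () ← trans (sym none) (some-intro p pi)

support : ∀ {N} → Rel N → Fin N → Bool
support X i = some (X i)

support-intro : ∀ {N} (X : Rel N) {i j} → X i j ≡ true → support X i ≡ true
support-intro X {i} = some-intro (X i)

support-elim : ∀ {N} (X : Rel N) {i} → support X i ≡ true → Σ (Fin N) λ j → X i j ≡ true
support-elim X {i} = some-elim (X i)

support-mono : ∀ {N} {X Y : Rel N} → X ⊆ Y → ∀ {i} → support X i ≡ true → support Y i ≡ true
support-mono {X = X} {Y} X⊆Y s with support-elim X s
... | j , xij = support-intro Y (X⊆Y _ j xij)

two-members⇒2≤card : ∀ {n} (p : Fin n → Bool) {a b} → p a ≡ true → p b ≡ true → ¬ b ≡ a →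
                     2 ≤ card p
two-members⇒2≤card p {a} {b} pa pb b≢a = subst (2 ≤_) (sym (card-remove p a pa))
  (s≤s (member⇒card-pos _ b (cong₂ (λ x y → not x ∧ y) (≢⇒==false b≢a) pb)))

2≤card⇒two-members : ∀ {n} (p : Fin n → Bool) → 2 ≤ card p →
  Σ (Fin n) λ a → Σ (Fin n) λ b → p a ≡ true × p b ≡ true × ¬ a ≡ b
2≤card⇒two-members p two with card-witness p (≤-trans (s≤s z≤n) two)
... | a , pa with card-witness (λ j → not (j == a) ∧ p j)
                   (s≤s⁻¹ (subst (2 ≤_) (card-remove p a pa) two))
...   | b , rest = a , b , pa , second rest , λ a≡b → first-distinct rest (sym a≡b)
  where
  second : ∀ {x y} → (not x ∧ y) ≡ true → y ≡ true
  second {false} e = e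
  first-distinct : (not (b == a) ∧ p b) ≡ true → ¬ b ≡ a
  first-distinct e refl rewrite ==-refl b with () ← e

-- X minus a sub-relation Y, written as a symmetric difference, stays inside X.
⊕-⊆ : ∀ {N} {X Y : Rel N} → Y ⊆ X → (X ⊕ Y) ⊆ X
⊕-⊆ {X = X} {Y} Y⊆X i j e with X i j in xij | Y i j in yij
... | true  | _     = refl
... | false | true  = trans (sym xij) (Y⊆X i j yij)
... | false | false with () ← e

triangle : ∀ {N} → Fin N → Fin N → Fin N → Rel N
triangle v u w = (edge v u ⊕ edge v w) ⊕ edge u w

module Triangle {N} {v u w : Fin N} (v≢u : ¬ v ≡ u) (v≢w : ¬ v ≡ w) (u≢w : ¬ u ≡ w) where

  T : Rel N
  T = triangle v u w

  symm : Symm T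
  symm = ⊕-symm (edge v u ⊕ edge v w) (edge u w)
           (⊕-symm (edge v u) (edge v w) (edge-symm v u) (edge-symm v w)) (edge-symm u w)

  irrefl : Irrefl T
  irrefl = ⊕-irrefl (edge v u ⊕ edge v w) (edge u w)
             (⊕-irrefl (edge v u) (edge v w) (edge-irrefl v≢u) (edge-irrefl v≢w)) (edge-irrefl u≢w)

  even : Even T
  even x = begin
      odd (deg T x)
    ≡⟨ odd-card-xor ((edge v u ⊕ edge v w) x) (edge u w x) ⟩
      odd (deg (edge v u ⊕ edge v w) x) xor odd (deg (edge u w) x)
    ≡⟨ cong (_xor odd (deg (edge u w) x)) (odd-card-xor (edge v u x) (edge v w x)) ⟩
      (odd (deg (edge v u) x) xor odd (deg (edge v w) x)) xor odd (deg (edge u w) x)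
    ≡⟨ cong₂ (λ p q → (p xor q) xor odd (deg (edge u w) x)) (odd-deg-edge v≢u x) (odd-deg-edge v≢w x) ⟩
      (((x == v) xor (x == u)) xor ((x == v) xor (x == w))) xor odd (deg (edge u w) x)
    ≡⟨ cong ((((x == v) xor (x == u)) xor ((x == v) xor (x == w))) xor_) (odd-deg-edge u≢w x) ⟩
      (((x == v) xor (x == u)) xor ((x == v) xor (x == w))) xor ((x == u) xor (x == w))
    ≡⟨ cancel (x == v) (x == u) (x == w) ⟩
      false
    ∎
    where
    open ≡-Reasoning
    cancel : ∀ a b c → ((a xor b) xor (a xor c)) xor (b xor c) ≡ false
    cancel true  true  true  = refl
    cancel true  true  false = refl
    cancel true  false true  = refl
    cancel true  false false = refl
    cancel false true  true  = refl
    cancel false true  false = refl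
    cancel false false true  = refl
    cancel false false false = refl

  side : ∀ i j → T i j ≡ true → edge v u i j ≡ true ⊎ edge v w i j ≡ true ⊎ edge u w i j ≡ true
  side i j e with edge v u i j | edge v w i j | edge u w i j
  ... | true  | _     | _    = inj₁ refl
  ... | false | true  | _    = inj₂ (inj₁ refl)
  ... | false | false | true = inj₂ (inj₂ refl)

  vu∈T : T v u ≡ true
  vu∈T = cong₂ _xor_ (cong₂ _xor_ (edge-at v u) vu∉vw) vu∉uw
    where
    vu∉vw : edge v w v u ≡ false
    vu∉vw = edge-false v w v u (λ { (_ , u≡w) → u≢w u≡w }) (λ { (v≡w , _) → v≢w v≡w })
    vu∉uw : edge u w v u ≡ false
    vu∉uw = edge-false u w v u (λ { (v≡u , _) → v≢u v≡u }) (λ { (v≡w , _) → v≢w v≡w })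

-- The cycle lemma.

edge-distinct : ∀ {N} {F : Rel N} → Irrefl F → ∀ {a b} → F a b ≡ true → ¬ a ≡ b
edge-distinct iF fab refl = case trans (sym fab) (iF _) of λ ()

record NonemptyEven {N} (F : Rel N) : Set where
  constructor nonemptyEven
  field
    C        : Rel N
    symm     : Symm C
    ⊆F       : C ⊆ F
    even     : Even C
    nonempty : Σ (Fin N) λ i → Σ (Fin N) λ j → C i j ≡ true

-- At least one edge, and at least as many edges as non-isolated vertices
-- (in terms of degree sums: 2 · |support F| ≤ Σ deg).
ManyEdges : ∀ {N} → Rel N → Set
ManyEdges F = 2 * card (support F) ≤ totalDeg F × 1 ≤ totalDeg F

many-edges-after : ∀ {N} {F F′ : Rel N} (S : Fin N → Bool) → totalDeg F′ + 2 ≡ totalDeg F →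
  (∀ i → support F′ i ≡ true → S i ≡ true) → 2 * card S + 2 ≤ totalDeg F → 1 ≤ card S →
  ManyEdges F′
many-edges-after {F = F} {F′} S shrink sub bound nonempty =
  ≤-trans (*-monoʳ-≤ 2 (card-mono sub)) 2S≤ , ≤-trans (≤-trans nonempty (m≤m+n _ _)) 2S≤
  where
  2S≤ : 2 * card S ≤ totalDeg F′
  2S≤ = +-cancelʳ-≤ 2 _ _ (subst (2 * card S + 2 ≤_) (sym shrink) bound)

-- The induction hypothesis of the cycle lemma below: reductions of F that remove
-- two edge-ends and keep many edges contain nonempty even subgraphs.
Reduces : ∀ {N} → Rel N → Set
Reduces {N} F = ∀ (F′ : Rel N) → Symm F′ → Irrefl F′ → totalDeg F′ + 2 ≡ totalDeg F →
                ManyEdges F′ → NonemptyEven F′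

NonemptyEven-mono : ∀ {N} {F F′ : Rel N} → F′ ⊆ F → NonemptyEven F′ → NonemptyEven F
NonemptyEven-mono F′⊆F (nonemptyEven C sC C⊆F′ eC ne) =
  nonemptyEven C sC (λ i j → F′⊆F i j ∘ C⊆F′ i j) eC ne

-- Suppressing the vertex v of a path u - v - w: replace the two edges vu, vw by
-- uw, i.e. toggle the three sides of the triangle vuw.
module Suppress {N} {F : Rel N} (sF : Symm F) (iF : Irrefl F)
                {v u w : Fin N} (fvu : F v u ≡ true) (fvw : F v w ≡ true) (u≢w : ¬ u ≡ w) where

  v≢u : ¬ v ≡ u
  v≢u = edge-distinct iF fvu

  v≢w : ¬ v ≡ w
  v≢w = edge-distinct iF fvw

  open Triangle v≢u v≢w u≢w using (T; side; vu∈T) renaming (symm to T-symm; irrefl to T-irrefl; even to T-even)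

  F′ : Rel N
  F′ = F ⊕ T

  symm : Symm F′
  symm = ⊕-symm F T sF T-symm

  irrefl : Irrefl F′
  irrefl = ⊕-irrefl F T iF T-irrefl

  T-uw⊆F : ∀ i j → T i j ≡ true → edge u w i j ≡ false → F i j ≡ true
  T-uw⊆F i j t n with side i j t
  ... | inj₁ e        = edge⊆ sF fvu i j e
  ... | inj₂ (inj₁ e) = edge⊆ sF fvw i j e
  ... | inj₂ (inj₂ e) = case trans (sym n) e of λ ()

  F₁ F₂ : Rel N
  F₁ = F ⊕ edge v u
  F₂ = F₁ ⊕ edge v w

  F′≗F₂⊕uw : ∀ i j → F′ i j ≡ (F₂ ⊕ edge u w) i j
  F′≗F₂⊕uw i j = trans (sym (xor-assoc (F i j) _ (edge u w i j)))
                       (cong (_xor edge u w i j) (sym (xor-assoc (F i j) (edge v u i j) (edge v w i j))))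

  F₁-symm : Symm F₁
  F₁-symm = ⊕-symm F (edge v u) sF (edge-symm v u)

  F₂-symm : Symm F₂
  F₂-symm = ⊕-symm F₁ (edge v w) F₁-symm (edge-symm v w)

  vw∉vu : edge v u v w ≡ false
  vw∉vu = edge-false v u v w (λ { (_ , w≡u) → u≢w (sym w≡u) }) (λ { (v≡u , _) → v≢u v≡u })

  uw∉vu : edge v u u w ≡ false
  uw∉vu = edge-false v u u w (λ { (u≡v , _) → v≢u (sym u≡v) }) (λ { (_ , w≡v) → v≢w (sym w≡v) })

  uw∉vw : edge v w u w ≡ false
  uw∉vw = edge-false v w u w (λ { (u≡v , _) → v≢u (sym u≡v) }) (λ { (u≡w , _) → u≢w u≡w })

  totalDeg-F′ : F u w ≡ false → totalDeg F′ + 2 ≡ totalDeg F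
  totalDeg-F′ fuw = begin
      totalDeg F′ + 2                    ≡⟨ cong (_+ 2) (totalDeg-cong F′≗F₂⊕uw) ⟩
      totalDeg (F₂ ⊕ edge u w) + 2       ≡⟨ cong (_+ 2) (add-edge F₂-symm u≢w f₂uw) ⟩
      totalDeg F₂ + 2 + 2                ≡⟨ cong (_+ 2) (delete-edge F₁-symm v≢w f₁vw) ⟩
      totalDeg F₁ + 2                    ≡⟨ delete-edge sF v≢u fvu ⟩
      totalDeg F                         ∎
    where
    open ≡-Reasoning
    f₁vw : F₁ v w ≡ true
    f₁vw = cong₂ _xor_ fvw vw∉vu
    f₂uw : F₂ u w ≡ false
    f₂uw = cong₂ _xor_ (cong₂ _xor_ fuw uw∉vu) uw∉vw

  support-F′ : ∀ i → support F′ i ≡ true → support F i ≡ true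
  support-F′ i s with support-elim F′ s
  ... | j , f′ij with F i j in fij
  ...   | true  = support-intro F fij
  ...   | false with side i j f′ij
  ...     | inj₁ e        = support-intro F (edge⊆ sF fvu i j e)
  ...     | inj₂ (inj₁ e) = support-intro F (edge⊆ sF fvw i j e)
  ...     | inj₂ (inj₂ e) with edge-ends u w i j e
  ...       | inj₁ (refl , _) = support-intro F (trans (sF u v) fvu)
  ...       | inj₂ (refl , _) = support-intro F (trans (sF w v) fvw)

  isolates-v : deg F v ≡ 2 → deg F′ v ≡ 0
  isolates-v dv = begin
      deg F′ v                 ≡⟨ card-cong (F′≗F₂⊕uw v) ⟩
      deg (F₂ ⊕ edge u w) v    ≡⟨ deg-toggle-away F₂ v≢u v≢w ⟩
      deg F₂ v                 ≡⟨ +-cancelʳ-≡ 2 _ _ after-vw ⟩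
      0                        ∎
    where
    open ≡-Reasoning
    after-vu : deg F₁ v + 2 ≡ 1 + 2
    after-vu = trans (cong (λ b → deg F₁ v + 2 * χ b) (sym fvu))
                  (trans (deg-toggle-end F v≢u) (cong (_+ 1) dv))
    after-vw : deg F₂ v + 2 ≡ 0 + 2
    after-vw = trans (cong (λ b → deg F₂ v + 2 * χ b) (sym (cong₂ _xor_ fvw vw∉vu)))
                  (trans (deg-toggle-end F₁ v≢w) (cong (_+ 1) (+-cancelʳ-≡ 2 (deg F₁ v) 1 after-vu)))

  triangle-cycle : F u w ≡ true → NonemptyEven F
  triangle-cycle fuw = nonemptyEven T T-symm T⊆F T-even (v , u , vu∈T)
    where
    T⊆F : T ⊆ F
    T⊆F i j t with side i j t
    ... | inj₁ e        = edge⊆ sF fvu i j e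
    ... | inj₂ (inj₁ e) = edge⊆ sF fvw i j e
    ... | inj₂ (inj₂ e) = edge⊆ sF fuw i j e

  -- a nonempty even subgraph of F′ yields one of F: either it avoids the new edge uw
  -- and lies in F, or toggling the triangle once more replaces uw by vu, vw
  lift : F u w ≡ false → NonemptyEven F′ → NonemptyEven F
  lift fuw (nonemptyEven C sC C⊆F′ eC ne) with C u w in cuw
  ... | false = nonemptyEven C sC C⊆F eC ne
    where
    avoids-uw : ∀ i j → edge u w i j ≡ true → C i j ≡ false
    avoids-uw i j e with edge-ends u w i j e
    ... | inj₁ (refl , refl) = cuw
    ... | inj₂ (refl , refl) = trans (sC w u) cuw
    keep : ∀ c f t e → (c ≡ true → (f xor t) ≡ true) → (t ≡ true → e ≡ false → f ≡ true) →
           (e ≡ true → c ≡ false) → c ≡ true → f ≡ true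
    keep true f false e c⇒ _ _ refl = trans (sym (xor-identityʳ f)) (c⇒ refl)
    keep true f true false _ t⇒ _ refl = t⇒ refl refl
    keep true f true true _ _ e⇒ refl with () ← e⇒ refl
    C⊆F : C ⊆ F
    C⊆F i j = keep (C i j) (F i j) (T i j) (edge u w i j) (C⊆F′ i j) (T-uw⊆F i j) (avoids-uw i j)
  ... | true = nonemptyEven (C ⊕ T) (⊕-symm C T sC T-symm) C⊕T⊆F (⊕-even C T eC T-even) (v , u , vu∈C⊕T)
    where
    contains-uw : ∀ i j → edge u w i j ≡ true → C i j ≡ true
    contains-uw i j e with edge-ends u w i j e
    ... | inj₁ (refl , refl) = cuw
    ... | inj₂ (refl , refl) = trans (sC w u) cuw
    swap : ∀ c f t e → (c ≡ true → (f xor t) ≡ true) → (t ≡ true → e ≡ false → f ≡ true) →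
           (e ≡ true → c ≡ true) → (c xor t) ≡ true → f ≡ true
    swap true  f false e c⇒ _ _ _ = trans (sym (xor-identityʳ f)) (c⇒ refl)
    swap false f true false _ t⇒ _ _ = t⇒ refl refl
    swap false f true true _ _ e⇒ _ with () ← e⇒ refl
    C⊕T⊆F : (C ⊕ T) ⊆ F
    C⊕T⊆F i j = swap (C i j) (F i j) (T i j) (edge u w i j) (C⊆F′ i j) (T-uw⊆F i j) (contains-uw i j)
    -- vu is not an edge of F′, so not of C, and toggling adds it
    vu∉C : C v u ≡ false
    vu∉C with C v u in cvu
    ... | false = refl
    ... | true with () ← trans (sym (C⊆F′ v u cvu)) (cong₂ _xor_ fvu vu∈T)
    vu∈C⊕T : (C ⊕ T) v u ≡ true
    vu∈C⊕T = cong₂ _xor_ vu∉C vu∈T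

  -- one step of the cycle lemma: either uw closes a triangle, or recurse on F′
  cycle-step : Reduces F → (S : Fin N → Bool) → (∀ i → support F′ i ≡ true → S i ≡ true) →
         2 * card S + 2 ≤ totalDeg F → 1 ≤ card S → NonemptyEven F
  cycle-step IH S sub bound nonempty with F u w in fuw
  ... | true  = triangle-cycle fuw
  ... | false = lift fuw (IH F′ symm irrefl (totalDeg-F′ fuw)
                              (many-edges-after S (totalDeg-F′ fuw) sub bound nonempty))

without : ∀ {N} → Fin N → (Fin N → Bool) → Fin N → Bool
without v S i = not (i == v) ∧ S i

drop-from-support : ∀ {N} {F : Rel N} {v u} → 2 * card (support F) ≤ totalDeg F →
  support F v ≡ true → support F u ≡ true → ¬ u ≡ v →
  2 * card (without v (support F)) + 2 ≤ totalDeg F × 1 ≤ card (without v (support F))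
drop-from-support {F = F} {v} {u} dense sv su u≢v =
  subst (_≤ totalDeg F) 2S+2≡ dense ,
  member⇒card-pos (without v (support F)) u (cong₂ (λ x y → not x ∧ y) (≢⇒==false u≢v) su)
  where
  2S+2≡ : 2 * card (support F) ≡ 2 * card (without v (support F)) + 2
  2S+2≡ = trans (cong (2 *_) (card-remove (support F) v sv))
                (trans (*-suc 2 _) (+-comm 2 _))

isolated⇒without : ∀ {N} {F F′ : Rel N} {v} → deg F′ v ≡ 0 →
  (∀ i → support F′ i ≡ true → support F i ≡ true) →
  ∀ i → support F′ i ≡ true → without v (support F) i ≡ true
isolated⇒without {F′ = F′} {v} dv sub i s with i == v in iv
... | false = sub i s
... | true with () ← trans (sym s) (trans (cong (support F′) (==⇒≡ i v iv)) (cong positive dv))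

leaf-step : ∀ {N} {F : Rel N} → Symm F → Irrefl F → 2 * card (support F) ≤ totalDeg F → Reduces F →
  ∀ {v u} → F v u ≡ true → deg F v ≡ 1 → NonemptyEven F
leaf-step {F = F} sF iF dense IH {v} {u} fvu dv
  with drop-from-support dense (support-intro F fvu) (support-intro F (trans (sF u v) fvu))
                         (edge-distinct iF (trans (sF u v) fvu))
... | bound , S-nonempty = NonemptyEven-mono F′⊆F
  (IH F′ (⊕-symm F (edge v u) sF (edge-symm v u)) (⊕-irrefl F (edge v u) iF (edge-irrefl v≢u)) shrink
      (many-edges-after (without v (support F)) shrink
        (isolated⇒without v-isolated (λ _ → support-mono F′⊆F)) bound S-nonempty))
  where
  v≢u = edge-distinct iF fvu
  F′ : Rel _
  F′ = F ⊕ edge v u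
  F′⊆F : F′ ⊆ F
  F′⊆F = ⊕-⊆ (edge⊆ sF fvu)
  shrink : totalDeg F′ + 2 ≡ totalDeg F
  shrink = delete-edge sF v≢u fvu
  v-isolated : deg F′ v ≡ 0
  v-isolated = +-cancelʳ-≡ 2 _ _ (trans (cong (λ b → deg F′ v + 2 * χ b) (sym fvu))
                                       (trans (deg-toggle-end F v≢u) (cong (_+ 1) dv)))

-- Degrees 1 and 2: the vertices at which a leaf deletion or a suppression
-- preserves the many-edges property.
low : ℕ → Bool
low 1 = true
low 2 = true
low _ = false

high-degree : ∀ d → ¬ low d ≡ true → 1 ≤ d → 3 ≤ d
high-degree 1 not-low _ = ⊥-elim (not-low refl)
high-degree 2 not-low _ = ⊥-elim (not-low refl)
high-degree (suc (suc (suc _))) _ _ = s≤s (s≤s (s≤s z≤n))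

three-per-vertex : ∀ {N} (F : Rel N) → (∀ v → ¬ low (deg F v) ≡ true) →
  3 * card (support F) ≤ totalDeg F
three-per-vertex F no-low =
  ≤-trans (≤-reflexive (*-distribˡ-sum 3 (λ v → χ (support F v))))
          (sum-mono (λ v → at-vertex (deg F v) (no-low v)))
  where
  at-vertex : ∀ d → ¬ low d ≡ true → 3 * χ (positive d) ≤ d
  at-vertex zero    _       = z≤n
  at-vertex (suc d) not-low = high-degree (suc d) not-low (s≤s z≤n)

reduce : ∀ {N} {F : Rel N} → Symm F → Irrefl F → ManyEdges F → Reduces F → NonemptyEven F
reduce {N} {F} sF iF (dense , nonempty) IH = case any? (λ v → low (deg F v) ≟ᵇ true) of λ where
    (yes (v , low-v)) → at-low-vertex v low-v
    (no no-low)       → at-high-vertex (λ v low-v → no-low (v , low-v))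
  where
  neighbours : ∀ {v} → 2 ≤ deg F v →
               Σ (Fin N) λ u → Σ (Fin N) λ w → F v u ≡ true × F v w ≡ true × ¬ u ≡ w
  neighbours = 2≤card⇒two-members (F _)

  far-end : ∀ {v u} → F v u ≡ true → support F u ≡ true
  far-end {v} {u} fvu = support-intro F (trans (sF u v) fvu)

  at-low-vertex : ∀ v → low (deg F v) ≡ true → NonemptyEven F
  at-low-vertex v low-v with deg F v in dv | low-v
  ... | 1 | _ = leaf-step sF iF dense IH (proj₂ (card-witness (F v) (≤-reflexive (sym dv)))) dv
  ... | 2 | _ with neighbours {v} (≤-reflexive (sym dv))
  ...   | u , w , fvu , fvw , u≢w
          with drop-from-support dense (support-intro F fvu) (far-end fvu) (edge-distinct iF (trans (sF u v) fvu))
  ...     | bound , S-nonempty = cycle-step IH (without v (support F))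
                                            (isolated⇒without (isolates-v dv) support-F′) bound S-nonempty
    where open Suppress sF iF fvu fvw u≢w

  at-high-vertex : (∀ v → ¬ low (deg F v) ≡ true) → NonemptyEven F
  at-high-vertex no-low with positive-term (deg F) nonempty
  ... | v , v-nonisolated with neighbours {v} (≤-trans (s≤s (s≤s z≤n)) (high-degree _ (no-low v) v-nonisolated))
  ...   | u , w , fvu , fvw , u≢w = cycle-step IH (support F) support-F′ bound S-nonempty
    where
    open Suppress sF iF fvu fvw u≢w
    2≤∣S∣ : 2 ≤ card (support F)
    2≤∣S∣ = two-members⇒2≤card (support F) (support-intro F fvu) (far-end fvu)
                               (edge-distinct iF (trans (sF u v) fvu))
    -- 2|S| + 2 ≤ 3|S| ≤ Σ deg F
    bound : 2 * card (support F) + 2 ≤ totalDeg F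
    bound = ≤-trans (+-monoʳ-≤ (2 * card (support F)) 2≤∣S∣)
                    (≤-trans (≤-reflexive (+-comm (2 * card (support F)) _)) (three-per-vertex F no-low))
    S-nonempty : 1 ≤ card (support F)
    S-nonempty = ≤-trans (s≤s z≤n) 2≤∣S∣

cycle-lemma : ∀ {N} (F : Rel N) → Symm F → Irrefl F → ManyEdges F → NonemptyEven F
cycle-lemma F = go F (<-wellFounded (totalDeg F))
  where
  go : ∀ F → Acc _<_ (totalDeg F) → Symm F → Irrefl F → ManyEdges F → NonemptyEven F
  go F (acc smaller) sF iF many = reduce sF iF many λ F′ sF′ iF′ shrink →
    go F′ (smaller (subst (totalDeg F′ <_) shrink (m<m+n (totalDeg F′) (s≤s z≤n)))) sF′ iF′

totalDeg-⊆ : ∀ {N} {C X : Rel N} → C ⊆ X →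
  totalDeg X ≡ totalDeg C + totalDeg (λ i j → not (C i j) ∧ X i j)
totalDeg-⊆ {C = C} {X} C⊆X =
  trans (totalDeg-split C X) (cong (_+ totalDeg (λ i j → not (C i j) ∧ X i j)) (totalDeg-cong inside))
  where
  inside : ∀ i j → (C i j ∧ X i j) ≡ C i j
  inside i j with C i j in cij
  ... | true  = C⊆X i j cij
  ... | false = refl

_∖_ : ∀ {N} → Rel N → Rel N → Rel N
(A ∖ E) i j = A i j ∧ not (E i j)

∖-⊕ : ∀ {N} {A E C : Rel N} → C ⊆ (A ∖ E) →
      ∀ i j → (A ∖ (E ⊕ C)) i j ≡ (not (C i j) ∧ (A ∖ E) i j)
∖-⊕ {A = A} {E} {C} C⊆A∖E i j with C i j in cij
... | false = cong (λ e → A i j ∧ not e) (xor-identityʳ (E i j))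
... | true  with A i j | E i j | C⊆A∖E i j cij
...   | true | false | _ = refl

-- Start from E = ∅; while A ∖ E has at least N edges, it contains a cycle (cycle lemma),
-- which is added to E.
large-even-subgraph : ∀ {N} → 1 ≤ N → (A : Rel N) → Symm A → Irrefl A →
  Σ (Rel N) λ E → Symm E × E ⊆ A × Even E × totalDeg A < totalDeg E + 2 * N
large-even-subgraph {N} 1≤N A sA iA =
  extend (λ _ _ → false) (<-wellFounded _) (λ _ _ → refl) (λ _ _ ()) (λ _ → cong odd (card-empty {N}))
  where
  extend : ∀ E → Acc _<_ (totalDeg (A ∖ E)) → Symm E → E ⊆ A → Even E →
           Σ (Rel N) λ E → Symm E × E ⊆ A × Even E × totalDeg A < totalDeg E + 2 * N
  extend E (acc smaller) sE E⊆A eE with 2 * N ≤? totalDeg (A ∖ E)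
  ... | no few = E , sE , E⊆A , eE ,
                 subst (_< totalDeg E + 2 * N) (sym A-split) (+-monoʳ-< (totalDeg E) (≰⇒> few))
    where
    A-split : totalDeg A ≡ totalDeg E + totalDeg (A ∖ E)
    A-split = trans (totalDeg-⊆ E⊆A)
                    (cong (totalDeg E +_) (totalDeg-cong (λ i j → ∧-comm (not (E i j)) (A i j))))
  ... | yes many with cycle-lemma (A ∖ E) sR iR (dense , ≤-trans (≤-trans 1≤N (m≤m+n N _)) many)
    where
    sR : Symm (A ∖ E)
    sR i j = cong₂ (λ a e → a ∧ not e) (sA i j) (sE i j)
    iR : Irrefl (A ∖ E)
    iR i = cong (_∧ not (E i i)) (iA i)
    dense : 2 * card (support (A ∖ E)) ≤ totalDeg (A ∖ E)
    dense = ≤-trans (*-monoʳ-≤ 2 (card≤n (support (A ∖ E)))) many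
  ... | nonemptyEven C sC C⊆A∖E eC (i , j , cij) =
        extend (E ⊕ C) (smaller shrinks) (⊕-symm E C sE sC) E⊕C⊆A (⊕-even E C eE eC)
    where
    E⊕C⊆A : (E ⊕ C) ⊆ A
    E⊕C⊆A i j e with E i j in eij
    ... | true  = E⊆A i j eij
    ... | false with A i j in aij | C⊆A∖E i j e
    ...   | true | _ = refl
    shrinks : totalDeg (A ∖ (E ⊕ C)) < totalDeg (A ∖ E)
    shrinks = subst (totalDeg (A ∖ (E ⊕ C)) <_)
      (sym (trans (totalDeg-⊆ {C = C} {A ∖ E} C⊆A∖E)
                  (cong (totalDeg C +_) (sym (totalDeg-cong (∖-⊕ {A = A} {E} C⊆A∖E))))))
      (+-monoˡ-≤ _ (totalDeg-pos C i j cij))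

-- Walks, restriction to a vertex set, and connected components.

data Walk {N} (X : Rel N) : Fin N → Fin N → Set where
  here : ∀ {u} → Walk X u u
  step : ∀ {u v w} → X u v ≡ true → Walk X v w → Walk X u w

_++ʷ_ : ∀ {N} {X : Rel N} {u v w} → Walk X u v → Walk X v w → Walk X u w
here       ++ʷ q = q
step e p   ++ʷ q = step e (p ++ʷ q)

reverseʷ : ∀ {N} {X : Rel N} → Symm X → ∀ {u v} → Walk X u v → Walk X v u
reverseʷ sX here                    = here
reverseʷ sX (step {u} {v} e p) = reverseʷ sX p ++ʷ step (trans (sX v u) e) here

walk-start : ∀ {N} {X : Rel N} {u v} → Walk X u v → u ≡ v ⊎ Σ (Fin N) λ w → X u w ≡ true
walk-start here             = inj₁ refl
walk-start (step {v = w} e _) = inj₂ (w , e)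

-- The edges of X with their first end in the vertex set K.
restrict : ∀ {N} → (Fin N → Bool) → Rel N → Rel N
restrict K X i j = K i ∧ X i j

module Restrict {N} {X : Rel N} (sX : Symm X) {K : Fin N → Bool}
                (closed : ∀ x y → K x ≡ true → X x y ≡ true → K y ≡ true) where

  same-side : ∀ i j → X i j ≡ true → K i ≡ K j
  same-side i j xij with K i in ki | K j in kj
  ... | true  | true  = refl
  ... | false | false = refl
  ... | true  | false with () ← trans (sym (closed i j ki xij)) kj
  ... | false | true  with () ← trans (sym (closed j i kj (trans (sX j i) xij))) ki

  restrict-symm : (g : Bool → Bool) → Symm (restrict (λ i → g (K i)) X)
  restrict-symm g i j with X i j in xij
  ... | true  = trans (cong (λ k → g k ∧ true) (same-side i j xij))
                      (cong (g (K j) ∧_) (trans (sym xij) (sX i j)))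
  ... | false = trans (∧-comm (g (K i)) false)
                      (sym (trans (cong (g (K j) ∧_) (trans (sX j i) xij)) (∧-comm (g (K j)) false)))

restrict-even : ∀ {N} {X : Rel N} (K : Fin N → Bool) → Even X → Even (restrict K X)
restrict-even {N} {X} K eX i with K i
... | true  = eX i
... | false = cong odd (card-empty {N})

record Piece {N} (X : Rel N) : Set where
  constructor piece
  field
    K         : Fin N → Bool
    inhabited : Σ (Fin N) λ x → K x ≡ true
    closed    : ∀ x y → K x ≡ true → X x y ≡ true → K y ≡ true
    connected : ∀ u v → K u ≡ true → K v ≡ true → Walk (restrict K X) u v

-- The connected component of x₀, computed as the ball of radius N around x₀: the
-- balls increase, and a ball equal to the next one stays constant, so by counting
-- they are constant from radius N on.
module Component {N} (X : Rel N) (sX : Symm X) (x₀ : Fin N) where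

  ball : ℕ → Fin N → Bool
  ball zero    y = y == x₀
  ball (suc k) y = ball k y ∨ some (λ x → ball k x ∧ X x y)

  ball-step : ∀ k {x y} → ball k x ≡ true → X x y ≡ true → ball (suc k) y ≡ true
  ball-step k {x} {y} bx xy with ball k y
  ... | true  = refl
  ... | false = some-intro (λ z → ball k z ∧ X z y) (cong₂ _∧_ bx xy)

  ball-suc : ∀ k y → ball (suc k) y ≡ true →
             ball k y ≡ true ⊎ Σ (Fin N) λ x → ball k x ≡ true × X x y ≡ true
  ball-suc k y b with ball k y
  ... | true  = inj₁ refl
  ... | false with some-elim (λ z → ball k z ∧ X z y) b
  ...   | x , bxy with ball k x in bx
  ...     | true = inj₂ (x , bx , bxy)

  ball-⊆-suc : ∀ k y → ball k y ≡ true → ball (suc k) y ≡ true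
  ball-⊆-suc k y b rewrite b = refl

  Stable : ℕ → Set
  Stable k = ∀ y → ball (suc k) y ≡ true → ball k y ≡ true

  stable-suc : ∀ k → Stable k → Stable (suc k)
  stable-suc k st y b with ball-suc (suc k) y b
  ... | inj₁ b′           = b′
  ... | inj₂ (x , bx , xy) = ball-step k (st x bx) xy

  grows : ∀ k → Stable k ⊎ suc k ≤ card (ball k)
  grows zero = inj₂ (member⇒card-pos (ball 0) x₀ (==-refl x₀))
  grows (suc k) with grows k
  ... | inj₁ st  = inj₁ (stable-suc k st)
  ... | inj₂ big with some (λ y → ball (suc k) y ∧ not (ball k y)) in new
  ...   | true  with some-elim (λ y → ball (suc k) y ∧ not (ball k y)) new
  ...     | y , fresh = inj₂ (≤-trans (s≤s big) (card-strict y (ball-⊆-suc k) (outside fresh) (inside fresh)))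
    where
    inside : ∀ {b c} → (b ∧ not c) ≡ true → b ≡ true
    inside {true} _ = refl
    outside : ∀ {b c} → (b ∧ not c) ≡ true → c ≡ false
    outside {true} {false} _ = refl
  grows (suc k) | inj₂ big | false = inj₁ (stable-suc k λ y b → old y b (some-false _ new y))
    where
    old : ∀ y → ball (suc k) y ≡ true → (ball (suc k) y ∧ not (ball k y)) ≡ false → ball k y ≡ true
    old y b rewrite b with ball k y
    ... | true = λ _ → refl

  K : Fin N → Bool
  K = ball N

  stable : Stable N
  stable with grows N
  ... | inj₁ st  = st
  ... | inj₂ big = ⊥-elim (1+n≰n (≤-trans big (card≤n (ball N))))

  closed : ∀ x y → K x ≡ true → X x y ≡ true → K y ≡ true
  closed x y kx xy = stable y (ball-step N kx xy)

  x₀∈K : K x₀ ≡ true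
  x₀∈K = centre N
    where
    centre : ∀ k → ball k x₀ ≡ true
    centre zero    = ==-refl x₀
    centre (suc k) = ball-⊆-suc k x₀ (centre k)

  ball⊆K : ∀ k y → ball k y ≡ true → K y ≡ true
  ball⊆K zero    y b rewrite ==⇒≡ y x₀ b = x₀∈K
  ball⊆K (suc k) y b with ball-suc k y b
  ... | inj₁ b′           = ball⊆K k y b′
  ... | inj₂ (x , bx , xy) = closed x y (ball⊆K k x bx) xy

  walk-to-x₀ : ∀ k y → ball k y ≡ true → Walk (restrict K X) y x₀
  walk-to-x₀ zero    y b rewrite ==⇒≡ y x₀ b = here
  walk-to-x₀ (suc k) y b with ball-suc k y b
  ... | inj₁ b′           = walk-to-x₀ k y b′
  ... | inj₂ (x , bx , xy) = step (cong₂ _∧_ (ball⊆K (suc k) y b) (trans (sX y x) xy)) (walk-to-x₀ k x bx)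

  component : Piece X
  component = piece K (x₀ , x₀∈K) closed λ u v ku kv →
    walk-to-x₀ N u ku ++ʷ reverseʷ (Restrict.restrict-symm sX closed (λ b → b)) (walk-to-x₀ N v kv)

averaging : ∀ a b k s d d′ → a * (k + s) ≤ (d + d′) * b → d * b < a * k → a * s < d′ * b
averaging a b k s d d′ whole part = +-cancelˡ-< (d * b) (a * s) (d′ * b) (begin-strict
  d * b + a * s    <⟨ +-monoˡ-< (a * s) part ⟩
  a * k + a * s    ≡⟨ *-distribˡ-+ a k s ⟨
  a * (k + s)      ≤⟨ whole ⟩
  (d + d′) * b     ≡⟨ *-distribʳ-+ b d d′ ⟩
  d * b + d′ * b   ∎)
  where open ≤-Reasoning

DensePiece : ∀ {N} → ℕ → ℕ → Rel N → Set
DensePiece {N} a b X = Σ (Rel N) λ X′ → X′ ⊆ X × Symm X′ × Even X′ ×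
                         Σ (Piece X′) λ P → a * card (Piece.K P) ≤ totalDeg (restrict (Piece.K P) X′) * b

-- Split off the
-- component K of a non-isolated vertex; if it is too sparse, the rest is dense enough.
dense-piece : ∀ {N} (a b : ℕ) (X : Rel N) → Symm X → Even X → 1 ≤ totalDeg X →
  (S : Fin N → Bool) → (∀ i → support X i ≡ true → S i ≡ true) → a * card S ≤ totalDeg X * b →
  DensePiece a b X
dense-piece {N} a b X = go X (<-wellFounded (totalDeg X))
  where
  go : ∀ X → Acc _<_ (totalDeg X) → Symm X → Even X → 1 ≤ totalDeg X →
       (S : Fin N → Bool) → (∀ i → support X i ≡ true → S i ≡ true) → a * card S ≤ totalDeg X * b →
       DensePiece a b X
  go X (acc smaller) sX eX nonempty S X⊆S dense with positive-term (deg X) nonempty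
  ... | x₀ , x₀-nonisolated with card-witness (X x₀) x₀-nonisolated
  ...   | j₀ , x₀j₀ with a * card K ≤? totalDeg (restrict K X) * b
    where open Component X sX x₀ using (K)
  ...     | yes K-dense = X , (λ _ _ x → x) , sX , eX , component , K-dense
    where open Component X sX x₀ using (K; component)
  ...     | no K-sparse with go Xʳ (smaller Xʳ<X) (restrict-symm not) (restrict-even (not ∘ K) eX)
                                rest-nonempty Sʳ Xʳ⊆Sʳ (<⇒≤ rest-dense)
    where
    open Component X sX x₀ using (K; closed; x₀∈K; walk-to-x₀)
    open Restrict sX closed using (restrict-symm)
    Xʳ : Rel N
    Xʳ = restrict (not ∘ K) X
    Sʳ : Fin N → Bool
    Sʳ i = not (K i) ∧ S i
    K⊆S : ∀ y → K y ≡ true → S y ≡ true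
    K⊆S y ky with walk-start (walk-to-x₀ N y ky)
    ... | inj₁ refl    = X⊆S x₀ (support-intro X x₀j₀)
    ... | inj₂ (w , e) with K y | X y w in xyw
    ...   | true | true = X⊆S y (support-intro X xyw)
    S-split : card S ≡ card K + card Sʳ
    S-split = trans (card-split K S) (cong (_+ card Sʳ) (card-cong inside))
      where
      inside : ∀ i → (K i ∧ S i) ≡ K i
      inside i with K i in ki
      ... | true  = K⊆S i ki
      ... | false = refl
    X-split : totalDeg X ≡ totalDeg (restrict K X) + totalDeg Xʳ
    X-split = totalDeg-split (λ i _ → K i) X
    rest-dense : a * card Sʳ < totalDeg Xʳ * b
    rest-dense = averaging a b (card K) (card Sʳ) (totalDeg (restrict K X)) (totalDeg Xʳ)
      (subst₂ (λ s d → a * s ≤ d * b) S-split X-split dense) (≰⇒> K-sparse)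
    rest-nonempty : 1 ≤ totalDeg Xʳ
    rest-nonempty with totalDeg Xʳ | rest-dense
    ... | suc _ | _ = s≤s z≤n
    Xʳ<X : totalDeg Xʳ < totalDeg X
    Xʳ<X = subst (totalDeg Xʳ <_) (sym X-split)
                 (+-monoˡ-≤ (totalDeg Xʳ) (totalDeg-pos (restrict K X) x₀ j₀ (cong₂ _∧_ x₀∈K x₀j₀)))
    Xʳ⊆Sʳ : ∀ i → support Xʳ i ≡ true → Sʳ i ≡ true
    Xʳ⊆Sʳ i s with support-elim Xʳ s
    ... | j , e with K i | X i j in xij
    ...   | false | true = X⊆S i (support-intro X xij)
  ...       | X′ , X′⊆Xʳ , rest = X′ , (λ i j → outside-K ∘ X′⊆Xʳ i j) , rest
    where
    outside-K : ∀ {k x} → (not k ∧ x) ≡ true → x ≡ true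
    outside-K {false} e = e

walk⇒reach : ∀ {G : Graph} (H : Subgraph G) {u v} → Walk (E' H) u v → Reach H u v
walk⇒reach H here       = here
walk⇒reach H (step e p) = step e (walk⇒reach H p)

module _ (G : Graph) {X : Rel (n G)} (X⊆G : X ⊆ adj G) (sX : Symm X) (eX : Even X) (P : Piece X) where
  open Piece P

  piece-subgraph : Subgraph G
  piece-subgraph = record
    { V'           = K
    ; E'           = restrict K X
    ; E'-sym       = Restrict.restrict-symm sX closed (λ b → b)
    ; E'⊆E         = λ i j e → X⊆G i j (in-X e)
    ; E'-endpoints = λ i j e → in-K e , closed i j (in-K e) (in-X e)
    }
    where
    in-K : ∀ {k x} → (k ∧ x) ≡ true → k ≡ true
    in-K {true} _ = refl
    in-X : ∀ {k x} → (k ∧ x) ≡ true → x ≡ true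
    in-X {true} e = e

  piece-eulerian : Eulerian piece-subgraph
  piece-eulerian = (nonempty , λ u v ku kv → walk⇒reach piece-subgraph (connected u v ku kv)) , even-degrees
    where
    nonempty : 1 ≤ vCount piece-subgraph
    nonempty with inhabited
    ... | x , kx = subst (1 ≤_) (sym (count≡card K)) (member⇒card-pos K x kx)
    even-degrees : ∀ v → K v ≡ true → 2 ∣ degree piece-subgraph v
    even-degrees v _ = subst (2 ∣_) (sym (count≡card (restrict K X v)))
                             (even⇒2∣ _ (restrict-even K eX v))

point : (G : Graph) → Fin (n G) → Subgraph G
point G x = record
  { V' = _== x ; E' = λ _ _ → false ; E'-sym = λ _ _ → refl ; E'⊆E = λ _ _ () ; E'-endpoints = λ _ _ () }

point-eulerian : (G : Graph) (x : Fin (n G)) → Eulerian (point G x)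
point-eulerian G x = (one , joined) , λ v _ → subst (2 ∣_) (sym no-edges) (divides 0 refl)
  where
  joined : ∀ u v → (u == x) ≡ true → (v == x) ≡ true → Reach (point G x) u v
  joined u v ux vx = subst (Reach (point G x) u) (trans (==⇒≡ u x ux) (sym (==⇒≡ v x vx))) here
  no-edges : count {n G} (λ _ → false) ≡ 0
  no-edges = trans (count≡card {n G} (λ _ → false)) (card-empty {n G})
  one : 1 ≤ vCount (point G x)
  one = subst (1 ≤_) (sym (count≡card (_== x))) (member⇒card-pos (_== x) x (==-refl x))

eulerian-part : (G : Graph) → 1 ≤ n G → (E : Rel (n G)) → Symm E → E ⊆ adj G → Even E →
  Σ (Subgraph G) λ H → Eulerian H × edgeCount E * vCount H ≤ eCount H * n G
eulerian-part G 1≤n E sE E⊆G eE with totalDeg E in dE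
... | zero  = point G x , point-eulerian G x ,
              subst (λ e → e * vCount (point G x) ≤ eCount (point G x) * n G) (sym no-edges) z≤n
  where
  no-edges : edgeCount E ≡ 0
  no-edges = *-cancelˡ-≡ _ 0 2 (trans (sym (handshake E sE (⊆-irrefl E⊆G (irref G)))) dE)
  x : Fin (n G)
  x = fromℕ< 1≤n
... | suc _ with dense-piece (totalDeg E) (n G) E sE eE (≤-trans (s≤s z≤n) (≤-reflexive (sym dE)))
                             (λ _ → true) (λ _ _ → refl) (≤-reflexive (cong (totalDeg E *_) (card-all (n G))))
...   | X , X⊆E , sX , eX , P , dense = H , piece-eulerian G X⊆G sX eX P , density
  where
  X⊆G = λ i j → E⊆G i j ∘ X⊆E i j
  H = piece-subgraph G X⊆G sX eX P
  density : edgeCount E * vCount H ≤ eCount H * n G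
  density = *-cancelˡ-≤ 2 (subst₂ _≤_ lhs rhs dense)
    where
    open Piece P using (K)
    lhs : totalDeg E * card K ≡ 2 * (edgeCount E * vCount H)
    lhs = trans (cong₂ _*_ (handshake E sE (⊆-irrefl E⊆G (irref G))) (sym (count≡card K)))
                (*-assoc 2 (edgeCount E) (vCount H))
    rhs : totalDeg (restrict K X) * n G ≡ 2 * (eCount H * n G)
    rhs = trans (cong (_* n G) (handshake (E' H) (E'-sym H) (⊆-irrefl (E'⊆E H) (irref G))))
                (*-assoc 2 (eCount H) (n G))

halve : ∀ m k n → 2 * m < 2 * k + 2 * n → m + 1 ≤ k + n
halve m k n lt = subst (_≤ k + n) (+-comm 1 m)
  (*-cancelˡ-< 2 m (k + n) (subst (2 * m <_) (sym (*-distribˡ-+ 2 k n)) lt))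

combine : ∀ eG eE eH n k → eG + 1 ≤ eE + n → eE * k ≤ eH * n → (eG + 1) * k ≤ eH * n + n * k
combine eG eE eH n k gap dense = begin
  (eG + 1) * k      ≤⟨ *-monoˡ-≤ k gap ⟩
  (eE + n) * k      ≡⟨ *-distribʳ-+ k eE n ⟩
  eE * k + n * k    ≤⟨ +-monoˡ-≤ (n * k) dense ⟩
  eH * n + n * k    ∎
  where open ≤-Reasoning

lemma23 : (G : Graph) → 1 ≤ n G →
    Σ (Subgraph G) λ H → Eulerian H ×
      ((edgeCount (adj G) + 1) * vCount H ≤ eCount H * n G + n G * vCount H)
lemma23 G 1≤n with large-even-subgraph 1≤n (adj G) (Graph.sym G) (irref G)
... | E , sE , E⊆G , eE , gap with eulerian-part G 1≤n E sE E⊆G eE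
...   | H , eulerian , dense =
  H , eulerian , combine (edgeCount (adj G)) (edgeCount E) (eCount H) (n G) (vCount H) edge-gap dense
  where
  edge-gap : edgeCount (adj G) + 1 ≤ edgeCount E + n G
  edge-gap = halve (edgeCount (adj G)) (edgeCount E) (n G) (subst₂ (λ a e → a < e + 2 * n G)
    (handshake (adj G) (Graph.sym G) (irref G)) (handshake E sE (⊆-irrefl E⊆G (irref G))) gap)
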